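{- Let $\Gamma$ be a sequent containing a sentence $\forall x.\varphi$, let $\alpha\in E$ and $d\in\mathbb N$. Suppose that for every $n\in\mathbb N$ there are $\alpha(n)\prec\alpha$, $d(n)\leq d$ and a sequent $\Delta_n\subseteq\Gamma\cup\{\varphi[x/\overline n]\}$ with $\vdash^{\alpha(n)}_{d(n)}\Delta_n$. Then $\vdash^\alpha_d\Gamma$.
   Context: $\mathcal L_{\mathsf{PA}}$ is the first-order language with $0,S,+,\times,\leq,=$; $\mathcal L^X_{\mathsf{PA}}$ adds a unary relation symbol $X$; $\overline n$ is the $n$-th numeral ($\overline 0=0$, $\overline{n+1}=S\overline n$). Formulas are in negation normal form (built from literals by $\land,\lor,\forall,\exists$), $\neg\varphi$ defined by de Morgan's laws. "True" refers to the standard model $\mathbb N$. Rank: literals $0$, $\mathrm{rk}(\varphi_0\land\varphi_1)=\mathrm{rk}(\varphi_0\lor\varphi_1)=\max+1$, $\mathrm{rk}(\forall x\varphi)=\mathrm{rk}(\exists x\varphi)=\mathrm{rk}(\varphi)+1$. $(E,\prec)$ is a well order with a map $\alpha\mapsto\alpha+1$ satisfying $\alpha\prec\alpha+1$, and elements $0,\omega\in E$ with $0\prec\omega$ such that $\alpha\prec\omega$ implies $\alpha+1\prec\omega$. $x\lhd y$ is a fixed $\mathcal L_{\mathsf{PA}}$-formula with free variables $x,y$ only, defining a well order on $\mathbb N$. A sequent is a finite set of $\mathcal L^X_{\mathsf{PA}}$-sentences; $\Gamma,\varphi$ denotes $\Gamma\cup\{\varphi\}$. By recursion on $\alpha\in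 E$, $\vdash^\alpha_d\Gamma$ holds exactly if one of: (i) $\Gamma$ contains a true $\mathcal L_{\mathsf{PA}}$-literal, or $Xs$ and $\neg Xt$ with closed terms $s,t$ of equal value; (ii) $\Gamma$ contains $\varphi_0\land\varphi_1$ (resp. $\varphi_0\lor\varphi_1$) and for every (resp. some) $i\in\{0,1\}$: $\vdash^{\alpha(i)}_{d(i)}\Delta_i$ with $\alpha(i)\prec\alpha$, $d(i)\leq d$, $\Delta_i\subseteq\Gamma,\varphi_i$; (iii) $\Gamma$ contains $\forall x\varphi$ (resp. $\exists x\varphi$) and for every (resp. some) closed term $t$: $\vdash^{\alpha(t)}_{d(t)}\Delta_t$ with $\alpha(t)\prec\alpha$, $d(t)\leq d$, $\Delta_t\subseteq\Gamma,\varphi[x/t]$; (iv) $\Gamma$ contains $Xt$ and for every closed term $s$ with $s\lhd t$ (by value): $\vdash^{\alpha(s)}_{d(s)}\Delta_s$ with $\alpha(s)\prec\alpha$, $d(s)\leq d$, $\Delta_s\subseteq\Gamma,Xs$; (v) for some sentence $\varphi$ with $\mathrm{rk}(\varphi)<d$: $\vdash^{\alpha(0)}_{d(0)}\Delta_0$ and $\vdash^{\alpha(1)}_{d(1)}\Delta_1$ with $\alpha(i)\prec\alpha$, $d(i)\leq d$, $\Delta_0\subseteq\Gamma,\varphi$, $\Delta_1\subseteq\Gamma,\neg\varphi$. -}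

module Defs where

open import Data.Nat using (ℕ; zero; suc; _+_; _*_; _≤_; _<_; _≟_; _⊔_)
open import Data.Empty using (⊥)
open import Data.Unit using (⊤)
open import Data.Sum using (_⊎_)
open import Data.Product using (Σ; _×_; ∃; _,_)
open import Data.List using (List; _∷_; [])
open import Data.List.Membership.Propositional using (_∈_)
open import Data.List.Relation.Binary.Subset.Propositional using (_⊆_)
open import Data.List.Relation.Unary.All using (All)
open import Relation.Nullary using (¬_; yes; no)
open import Relation.Binary.PropositionalEquality using (_≡_)
open import Relation.Binary.Structures using (IsStrictTotalOrder)
open import Induction.WellFounded using (WellFounded)

data Term : Set where
  var  : ℕ → Term
  `0   : Term
  `S   : Term → Term
  _`+_ : Term → Term → Term
  _`×_ : Term → Term → Term

num : ℕ → Term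
num zero    = `0
num (suc n) = `S (num n)

-- Formulas in negation normal form
data Formula : Set where
  _`=_  : Term → Term → Formula
  _`≠_  : Term → Term → Formula
  _`≤_  : Term → Term → Formula
  _`≰_  : Term → Term → Formula
  `X    : Term → Formula
  `¬X   : Term → Formula
  _`∧_  : Formula → Formula → Formula
  _`∨_  : Formula → Formula → Formula
  `∀    : ℕ → Formula → Formula
  `∃    : ℕ → Formula → Formula

neg : Formula → Formula
neg (s `= t) = s `≠ t
neg (s `≠ t) = s `= t
neg (s `≤ t) = s `≰ t
neg (s `≰ t) = s `≤ t
neg (`X t)   = `¬X t
neg (`¬X t)  = `X t
neg (φ `∧ ψ) = neg φ `∨ neg ψ
neg (φ `∨ ψ) = neg φ `∧ neg ψ
neg (`∀ x φ) = `∃ x (neg φ)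
neg (`∃ x φ) = `∀ x (neg φ)

rk : Formula → ℕ
rk (φ `∧ ψ) = suc (rk φ ⊔ rk ψ)
rk (φ `∨ ψ) = suc (rk φ ⊔ rk ψ)
rk (`∀ x φ) = suc (rk φ)
rk (`∃ x φ) = suc (rk φ)
rk _        = 0

data OccT (x : ℕ) : Term → Set where
  var  : OccT x (var x)
  S    : ∀ {t} → OccT x t → OccT x (`S t)
  +l   : ∀ {s t} → OccT x s → OccT x (s `+ t)
  +r   : ∀ {s t} → OccT x t → OccT x (s `+ t)
  ×l   : ∀ {s t} → OccT x s → OccT x (s `× t)
  ×r   : ∀ {s t} → OccT x t → OccT x (s `× t)

ClosedTerm : Term → Set
ClosedTerm t = ∀ x → ¬ OccT x t

data Free (x : ℕ) : Formula → Set where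
  =l : ∀ {s t} → OccT x s → Free x (s `= t)
  =r : ∀ {s t} → OccT x t → Free x (s `= t)
  ≠l : ∀ {s t} → OccT x s → Free x (s `≠ t)
  ≠r : ∀ {s t} → OccT x t → Free x (s `≠ t)
  ≤l : ∀ {s t} → OccT x s → Free x (s `≤ t)
  ≤r : ∀ {s t} → OccT x t → Free x (s `≤ t)
  ≰l : ∀ {s t} → OccT x s → Free x (s `≰ t)
  ≰r : ∀ {s t} → OccT x t → Free x (s `≰ t)
  X  : ∀ {t} → OccT x t → Free x (`X t)
  ¬X : ∀ {t} → OccT x t → Free x (`¬X t)
  ∧l : ∀ {φ ψ} → Free x φ → Free x (φ `∧ ψ)
  ∧r : ∀ {φ ψ} → Free x ψ → Free x (φ `∧ ψ)
  ∨l : ∀ {φ ψ} → Free x φ → Free x (φ `∨ ψ)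
  ∨r : ∀ {φ ψ} → Free x ψ → Free x (φ `∨ ψ)
  ∀b : ∀ {y φ} → ¬ (x ≡ y) → Free x φ → Free x (`∀ y φ)
  ∃b : ∀ {y φ} → ¬ (x ≡ y) → Free x φ → Free x (`∃ y φ)

Sentence : Formula → Set
Sentence φ = ∀ x → ¬ Free x φ

data PAFormula : Formula → Set where
  pa= : ∀ {s t} → PAFormula (s `= t)
  pa≠ : ∀ {s t} → PAFormula (s `≠ t)
  pa≤ : ∀ {s t} → PAFormula (s `≤ t)
  pa≰ : ∀ {s t} → PAFormula (s `≰ t)
  pa∧ : ∀ {φ ψ} → PAFormula φ → PAFormula ψ → PAFormula (φ `∧ ψ)
  pa∨ : ∀ {φ ψ} → PAFormula φ → PAFormula ψ → PAFormula (φ `∨ ψ)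
  pa∀ : ∀ {x φ} → PAFormula φ → PAFormula (`∀ x φ)
  pa∃ : ∀ {x φ} → PAFormula φ → PAFormula (`∃ x φ)

-- substitution φ[x/t] (only used for closed t, so no capture issues)
substT : ℕ → Term → Term → Term
substT x t (var y) with x ≟ y
... | yes _ = t
... | no  _ = var y
substT x t `0       = `0
substT x t (`S u)   = `S (substT x t u)
substT x t (u `+ v) = substT x t u `+ substT x t v
substT x t (u `× v) = substT x t u `× substT x t v

subst : ℕ → Term → Formula → Formula
subst x t (u `= v) = substT x t u `= substT x t v
subst x t (u `≠ v) = substT x t u `≠ substT x t v
subst x t (u `≤ v) = substT x t u `≤ substT x t v
subst x t (u `≰ v) = substT x t u `≰ substT x t v
subst x t (`X u)   = `X (substT x t u)
subst x t (`¬X u)  = `¬X (substT x t u)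
subst x t (φ `∧ ψ) = subst x t φ `∧ subst x t ψ
subst x t (φ `∨ ψ) = subst x t φ `∨ subst x t ψ
subst x t (`∀ y φ) with x ≟ y
... | yes _ = `∀ y φ
... | no  _ = `∀ y (subst x t φ)
subst x t (`∃ y φ) with x ≟ y
... | yes _ = `∃ y φ
... | no  _ = `∃ y (subst x t φ)

Env : Set
Env = ℕ → ℕ

_[_↦_] : Env → ℕ → ℕ → Env
(ρ [ x ↦ n ]) y with x ≟ y
... | yes _ = n
... | no  _ = ρ y

evalE : Env → Term → ℕ
evalE ρ (var x)  = ρ x
evalE ρ `0       = 0
evalE ρ (`S t)   = suc (evalE ρ t)
evalE ρ (s `+ t) = evalE ρ s + evalE ρ t
evalE ρ (s `× t) = evalE ρ s * evalE ρ t

val : Term → ℕ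
val = evalE (λ _ → 0)

Sat : (ℕ → Set) → Env → Formula → Set
Sat P ρ (s `= t) = evalE ρ s ≡ evalE ρ t
Sat P ρ (s `≠ t) = ¬ (evalE ρ s ≡ evalE ρ t)
Sat P ρ (s `≤ t) = evalE ρ s ≤ evalE ρ t
Sat P ρ (s `≰ t) = ¬ (evalE ρ s ≤ evalE ρ t)
Sat P ρ (`X t)   = P (evalE ρ t)
Sat P ρ (`¬X t)  = ¬ P (evalE ρ t)
Sat P ρ (φ `∧ ψ) = Sat P ρ φ × Sat P ρ ψ
Sat P ρ (φ `∨ ψ) = Sat P ρ φ ⊎ Sat P ρ ψ
Sat P ρ (`∀ x φ) = (n : ℕ) → Sat P (ρ [ x ↦ n ]) φ
Sat P ρ (`∃ x φ) = Σ ℕ λ n → Sat P (ρ [ x ↦ n ]) φ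

TrueLit : Formula → Set
TrueLit (s `= t) = val s ≡ val t
TrueLit (s `≠ t) = ¬ (val s ≡ val t)
TrueLit (s `≤ t) = val s ≤ val t
TrueLit (s `≰ t) = ¬ (val s ≤ val t)
TrueLit _        = ⊥

record OrdinalNotation : Set₁ where
  field
    E        : Set
    _≺_      : E → E → Set
    isSTO    : IsStrictTotalOrder _≡_ _≺_
    wf       : WellFounded _≺_
    _+1      : E → E
    ≺+1      : ∀ α → α ≺ (α +1)
    𝟎        : E
    ω        : E
    𝟎≺ω      : 𝟎 ≺ ω
    ω-closed : ∀ α → α ≺ ω → (α +1) ≺ ω

record WellOrderFormula : Set where
  field
    vx vy  : ℕ
    vx≢vy  : ¬ (vx ≡ vy)
    form   : Formula
    isPA   : PAFormula form
    onlyFV : ∀ z → Free z form → z ≡ vx ⊎ z ≡ vy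
  _⊲_ : ℕ → ℕ → Set
  m ⊲ n = Sat (λ _ → ⊥) (((λ _ → 0) [ vx ↦ m ]) [ vy ↦ n ]) form
  field
    ⊲-isSTO : IsStrictTotalOrder _≡_ _⊲_
    ⊲-wf    : WellFounded _⊲_

Sequent : Set
Sequent = List Formula

module Calculus (O : OrdinalNotation) (W : WellOrderFormula) where
  open OrdinalNotation O
  open WellOrderFormula W

  mutual
    data ⊢ : E → ℕ → Sequent → Set where
      ax-lit : ∀ {α d Γ φ} → φ ∈ Γ → TrueLit φ → ⊢ α d Γ
      ax-X   : ∀ {α d Γ s t} → `X s ∈ Γ → `¬X t ∈ Γ → val s ≡ val t → ⊢ α d Γ
      r∧ : ∀ {α d Γ φ₀ φ₁} → (φ₀ `∧ φ₁) ∈ Γ →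
           Prem α d Γ φ₀ → Prem α d Γ φ₁ → ⊢ α d Γ
      r∨ : ∀ {α d Γ φ₀ φ₁} → (φ₀ `∨ φ₁) ∈ Γ →
           Prem α d Γ φ₀ ⊎ Prem α d Γ φ₁ → ⊢ α d Γ
      r∀ : ∀ {α d Γ x φ} → `∀ x φ ∈ Γ →
           ((t : Term) → ClosedTerm t → Prem α d Γ (subst x t φ)) → ⊢ α d Γ
      r∃ : ∀ {α d Γ x φ} → `∃ x φ ∈ Γ →
           Σ Term (λ t → ClosedTerm t × Prem α d Γ (subst x t φ)) → ⊢ α d Γ
      rX : ∀ {α d Γ t} → `X t ∈ Γ →
           ((s : Term) → ClosedTerm s → val s ⊲ val t → Prem α d Γ (`X s)) → ⊢ α d Γ
      cut : ∀ {α d Γ} (φ : Formula) → Sentence φ → rk φ < d →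
            Prem α d Γ φ → Prem α d Γ (neg φ) → ⊢ α d Γ

    data Prem (α : E) (d : ℕ) (Γ : Sequent) (φ : Formula) : Set where
      prem : (α' : E) (d' : ℕ) (Δ : Sequent) →
             α' ≺ α → d' ≤ d → Δ ⊆ (φ ∷ Γ) → ⊢ α' d' Δ → Prem α d Γ φ

-- Rule (iii) demands premises for every closed term t, the hypothesis gives them for
-- numerals. But φ[x/t] and φ[x/num (val t)] differ only by terms that have the same value
-- in every environment, and no rule of the calculus distinguishes such terms: the truth
-- of literals, the values compared in X-axioms and by ⊲, and instances of quantifier rules
-- are all preserved. So derivations transport along this congruence of sequents.
module Submission where

open import Defs
open import Data.Nat using (ℕ; _≤_; _≟_; zero; suc; _+_; _*_)
open import Data.Product using (Σ; _×_; _,_)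
open import Data.List using (_∷_)
open import Data.List.Membership.Propositional using (_∈_)
open import Data.List.Relation.Binary.Subset.Propositional using (_⊆_)
open import Data.List.Relation.Unary.All using (All)
open import Data.List.Relation.Unary.Any using (here; there)
open import Data.Sum using (inj₁; inj₂)
open import Data.Empty using (⊥-elim)
open import Relation.Nullary using (yes; no)
open import Relation.Binary.PropositionalEquality
  using (_≡_; refl; sym; trans; cong; cong₂; subst₂)
open Relation.Binary.PropositionalEquality.≡-Reasoning

infix 4 _≈ₜ_ _≈_

record _≈ₜ_ (s t : Term) : Set where
  constructor eval-≡⇒≈ₜ
  field eval-≡ : ∀ ρ → evalE ρ s ≡ evalE ρ t
open _≈ₜ_

data _≈_ : Formula → Formula → Set where
  ≈-=  : ∀ {s s' t t'} → s ≈ₜ s' → t ≈ₜ t' → (s `= t) ≈ (s' `= t')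
  ≈-≠  : ∀ {s s' t t'} → s ≈ₜ s' → t ≈ₜ t' → (s `≠ t) ≈ (s' `≠ t')
  ≈-≤  : ∀ {s s' t t'} → s ≈ₜ s' → t ≈ₜ t' → (s `≤ t) ≈ (s' `≤ t')
  ≈-≰  : ∀ {s s' t t'} → s ≈ₜ s' → t ≈ₜ t' → (s `≰ t) ≈ (s' `≰ t')
  ≈-X  : ∀ {s s'} → s ≈ₜ s' → `X s ≈ `X s'
  ≈-¬X : ∀ {s s'} → s ≈ₜ s' → `¬X s ≈ `¬X s'
  ≈-∧  : ∀ {φ φ' ψ ψ'} → φ ≈ φ' → ψ ≈ ψ' → (φ `∧ ψ) ≈ (φ' `∧ ψ')
  ≈-∨  : ∀ {φ φ' ψ ψ'} → φ ≈ φ' → ψ ≈ ψ' → (φ `∨ ψ) ≈ (φ' `∨ ψ')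
  ≈-∀  : ∀ {y φ φ'} → φ ≈ φ' → `∀ y φ ≈ `∀ y φ'
  ≈-∃  : ∀ {y φ φ'} → φ ≈ φ' → `∃ y φ ≈ `∃ y φ'

≈ₜ-refl : ∀ t → t ≈ₜ t
≈ₜ-refl t = eval-≡⇒≈ₜ λ ρ → refl

≈-refl : ∀ φ → φ ≈ φ
≈-refl (s `= t) = ≈-= (≈ₜ-refl s) (≈ₜ-refl t)
≈-refl (s `≠ t) = ≈-≠ (≈ₜ-refl s) (≈ₜ-refl t)
≈-refl (s `≤ t) = ≈-≤ (≈ₜ-refl s) (≈ₜ-refl t)
≈-refl (s `≰ t) = ≈-≰ (≈ₜ-refl s) (≈ₜ-refl t)
≈-refl (`X t)   = ≈-X (≈ₜ-refl t)
≈-refl (`¬X t)  = ≈-¬X (≈ₜ-refl t)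
≈-refl (φ `∧ ψ) = ≈-∧ (≈-refl φ) (≈-refl ψ)
≈-refl (φ `∨ ψ) = ≈-∨ (≈-refl φ) (≈-refl ψ)
≈-refl (`∀ y φ) = ≈-∀ (≈-refl φ)
≈-refl (`∃ y φ) = ≈-∃ (≈-refl φ)

evalE-substT : ∀ ρ y u s → evalE ρ (substT y u s) ≡ evalE (ρ [ y ↦ evalE ρ u ]) s
evalE-substT ρ y u (var z) with y ≟ z
... | yes _ = refl
... | no  _ = refl
evalE-substT ρ y u `0       = refl
evalE-substT ρ y u (`S s)   = cong suc (evalE-substT ρ y u s)
evalE-substT ρ y u (s `+ t) = cong₂ _+_ (evalE-substT ρ y u s) (evalE-substT ρ y u t)
evalE-substT ρ y u (s `× t) = cong₂ _*_ (evalE-substT ρ y u s) (evalE-substT ρ y u t)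

substT-cong : ∀ y {u u' s s'} → u ≈ₜ u' → s ≈ₜ s' → substT y u s ≈ₜ substT y u' s'
substT-cong y {u} {u'} {s} {s'} u≈u' s≈s' = eval-≡⇒≈ₜ λ ρ → begin
  evalE ρ (substT y u s)            ≡⟨ evalE-substT ρ y u s ⟩
  evalE (ρ [ y ↦ evalE ρ u ]) s     ≡⟨ cong (λ k → evalE (ρ [ y ↦ k ]) s) (eval-≡ u≈u' ρ) ⟩
  evalE (ρ [ y ↦ evalE ρ u' ]) s    ≡⟨ eval-≡ s≈s' _ ⟩
  evalE (ρ [ y ↦ evalE ρ u' ]) s'   ≡⟨ evalE-substT ρ y u' s' ⟨
  evalE ρ (substT y u' s')          ∎

subst-cong : ∀ y {u u' φ φ'} → u ≈ₜ u' → φ ≈ φ' → subst y u φ ≈ subst y u' φ'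
subst-cong y e (≈-= p q) = ≈-= (substT-cong y e p) (substT-cong y e q)
subst-cong y e (≈-≠ p q) = ≈-≠ (substT-cong y e p) (substT-cong y e q)
subst-cong y e (≈-≤ p q) = ≈-≤ (substT-cong y e p) (substT-cong y e q)
subst-cong y e (≈-≰ p q) = ≈-≰ (substT-cong y e p) (substT-cong y e q)
subst-cong y e (≈-X p)   = ≈-X (substT-cong y e p)
subst-cong y e (≈-¬X p)  = ≈-¬X (substT-cong y e p)
subst-cong y e (≈-∧ p q) = ≈-∧ (subst-cong y e p) (subst-cong y e q)
subst-cong y e (≈-∨ p q) = ≈-∨ (subst-cong y e p) (subst-cong y e q)
subst-cong y e (≈-∀ {z} p) with y ≟ z
... | yes _ = ≈-∀ p
... | no  _ = ≈-∀ (subst-cong y e p)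
subst-cong y e (≈-∃ {z} p) with y ≟ z
... | yes _ = ≈-∃ p
... | no  _ = ≈-∃ (subst-cong y e p)

evalE-closed : ∀ t → ClosedTerm t → ∀ ρ → evalE ρ t ≡ val t
evalE-closed (var x)  c ρ = ⊥-elim (c x var)
evalE-closed `0       c ρ = refl
evalE-closed (`S t)   c ρ = cong suc (evalE-closed t (λ x o → c x (S o)) ρ)
evalE-closed (s `+ t) c ρ =
  cong₂ _+_ (evalE-closed s (λ x o → c x (+l o)) ρ) (evalE-closed t (λ x o → c x (+r o)) ρ)
evalE-closed (s `× t) c ρ =
  cong₂ _*_ (evalE-closed s (λ x o → c x (×l o)) ρ) (evalE-closed t (λ x o → c x (×r o)) ρ)

evalE-num : ∀ ρ n → evalE ρ (num n) ≡ n
evalE-num ρ zero    = refl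
evalE-num ρ (suc n) = cong suc (evalE-num ρ n)

num-val≈ₜ : ∀ t → ClosedTerm t → num (val t) ≈ₜ t
num-val≈ₜ t c = eval-≡⇒≈ₜ λ ρ → trans (evalE-num ρ (val t)) (sym (evalE-closed t c ρ))

TrueLit-resp-≈ : ∀ {φ φ'} → φ ≈ φ' → TrueLit φ → TrueLit φ'
TrueLit-resp-≈ (≈-= p q) h = trans (sym (eval-≡ p _)) (trans h (eval-≡ q _))
TrueLit-resp-≈ (≈-≠ p q) h = λ e → h (trans (eval-≡ p _) (trans e (sym (eval-≡ q _))))
TrueLit-resp-≈ (≈-≤ p q) h = subst₂ _≤_ (eval-≡ p _) (eval-≡ q _) h
TrueLit-resp-≈ (≈-≰ p q) h = λ le → h (subst₂ _≤_ (sym (eval-≡ p _)) (sym (eval-≡ q _)) le)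

module _ (O : OrdinalNotation) (W : WellOrderFormula) where
  open WellOrderFormula W
  open Calculus O W

  infix 4 _⊆≈_

  _⊆≈_ : Sequent → Sequent → Set
  Γ ⊆≈ Γ' = ∀ {ψ} → ψ ∈ Γ → Σ Formula λ ψ' → ψ' ∈ Γ' × ψ ≈ ψ'

  ⊆⇒⊆≈ : ∀ {Γ Γ'} → Γ ⊆ Γ' → Γ ⊆≈ Γ'
  ⊆⇒⊆≈ Γ⊆Γ' {ψ} ψ∈Γ = ψ , Γ⊆Γ' ψ∈Γ , ≈-refl ψ

  ∷-⊆≈ : ∀ {Γ Γ' χ χ'} → χ ≈ χ' → Γ ⊆≈ Γ' → χ ∷ Γ ⊆≈ χ' ∷ Γ'
  ∷-⊆≈ χ≈χ' Γ⊆≈Γ' (here refl) = _ , here refl , χ≈χ'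
  ∷-⊆≈ χ≈χ' Γ⊆≈Γ' (there ψ∈Γ) with Γ⊆≈Γ' ψ∈Γ
  ... | ψ' , ψ'∈Γ' , ψ≈ψ' = ψ' , there ψ'∈Γ' , ψ≈ψ'

  mutual
    ⊢-resp-⊆≈ : ∀ {α d Γ Γ'} → ⊢ α d Γ → Γ ⊆≈ Γ' → ⊢ α d Γ'
    ⊢-resp-⊆≈ (ax-lit m l) R with R m
    ... | _ , m' , e = ax-lit m' (TrueLit-resp-≈ e l)
    ⊢-resp-⊆≈ (ax-X m₁ m₂ e) R with R m₁ | R m₂
    ... | _ , m₁' , ≈-X p | _ , m₂' , ≈-¬X q = ax-X m₁' m₂' (trans (sym (eval-≡ p _)) (trans e (eval-≡ q _)))
    ⊢-resp-⊆≈ (r∧ m P Q) R with R m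
    ... | _ , m' , ≈-∧ p q = r∧ m' (Prem-resp-⊆≈ P R p) (Prem-resp-⊆≈ Q R q)
    ⊢-resp-⊆≈ (r∨ m (inj₁ P)) R with R m
    ... | _ , m' , ≈-∨ p q = r∨ m' (inj₁ (Prem-resp-⊆≈ P R p))
    ⊢-resp-⊆≈ (r∨ m (inj₂ Q)) R with R m
    ... | _ , m' , ≈-∨ p q = r∨ m' (inj₂ (Prem-resp-⊆≈ Q R q))
    ⊢-resp-⊆≈ (r∀ {x = y} m f) R with R m
    ... | _ , m' , ≈-∀ p = r∀ m' λ t c → Prem-resp-⊆≈ (f t c) R (subst-cong y (≈ₜ-refl t) p)
    ⊢-resp-⊆≈ (r∃ {x = y} m (t , c , P)) R with R m
    ... | _ , m' , ≈-∃ p = r∃ m' (t , c , Prem-resp-⊆≈ P R (subst-cong y (≈ₜ-refl t) p))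
    ⊢-resp-⊆≈ (rX m f) R with R m
    ... | _ , m' , ≈-X p = rX m' λ s c s⊲t' →
      Prem-resp-⊆≈ (f s c (subst₂ _⊲_ refl (sym (eval-≡ p _)) s⊲t')) R (≈-X (≈ₜ-refl s))
    ⊢-resp-⊆≈ (cut φ sφ r P Q) R =
      cut φ sφ r (Prem-resp-⊆≈ P R (≈-refl φ)) (Prem-resp-⊆≈ Q R (≈-refl (neg φ)))

    Prem-resp-⊆≈ : ∀ {α d Γ Γ' χ χ'} → Prem α d Γ χ → Γ ⊆≈ Γ' → χ ≈ χ' → Prem α d Γ' χ'
    Prem-resp-⊆≈ (prem α' d' Δ α'≺α d'≤d Δ⊆ D) R χ≈χ' =
      prem α' d' _ α'≺α d'≤d (λ m → m) (⊢-resp-⊆≈ D λ m → ∷-⊆≈ χ≈χ' R (Δ⊆ m))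

lemma3p6 : (O : OrdinalNotation) (W : WellOrderFormula) →
    let open OrdinalNotation O in
    (Γ : Sequent) → All Sentence Γ →
    (x : ℕ) (φ : Formula) → `∀ x φ ∈ Γ →
    (α : E) (d : ℕ) →
    ((n : ℕ) → Σ E λ αn → Σ ℕ λ dn → Σ Sequent λ Δn →
       αn ≺ α × dn ≤ d × Δn ⊆ (subst x (num n) φ ∷ Γ) × Calculus.⊢ O W αn dn Δn) →
    Calculus.⊢ O W α d Γ
lemma3p6 O W Γ _ x φ ∀xφ∈Γ α d premises = Calculus.r∀ ∀xφ∈Γ premise
  where
  premise : ∀ t → ClosedTerm t → Calculus.Prem O W α d Γ (subst x t φ)
  premise t c with premises (val t)
  ... | αn , dn , Δn , αn≺α , dn≤d , Δn⊆ , D =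
    Prem-resp-⊆≈ O W (Calculus.prem αn dn Δn αn≺α dn≤d Δn⊆ D) (⊆⇒⊆≈ O W (λ m → m))
      (subst-cong x (num-val≈ₜ t c) (≈-refl φ))
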